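{- Let $m,k$ be positive integers, $\delta\in\mathbb{F}_{2^{2m}}$, and $i$ an integer with $0<i<m$. Let $$f_2(x)=x+\left(\mathrm{Tr}_m^{2m}(x)^k+\delta\right)^{2^i+1}+\left(\mathrm{Tr}_m^{2m}(x)^k+\delta\right)^{2^m+2^i},$$ $$f_3(x)=x+\left(\mathrm{Tr}_m^{2m}(x)^k+\delta\right)^{2^i+1}+\left(\mathrm{Tr}_m^{2m}(x)^k+\delta\right)^{2^{m+i}+1}.$$ Then $f_2$ and $f_3$ are permutation polynomials of $\mathbb{F}_{2^{2m}}$ and, writing $E=(\delta+\delta^{2^m})^{2^i+1}$, their compositional inverses over $\mathbb{F}_{2^{2m}}$ are $$f_2^{ -1}(x)=x+\left(\left(\mathrm{Tr}_m^{2m}(x)+E\right)^k+\delta\right)^{2^i+1}+\left(\left(\mathrm{Tr}_m^{2m}(x)+E\right)^k+\delta\right)^{2^i+2^m},$$ $$f_3^{ -1}(x)=x+\left(\left(\mathrm{Tr}_m^{2m}(x)+E\right)^k+\delta\right)^{2^i+1}+\left(\left(\mathrm{Tr}_m^{2m}(x)+E\right)^k+\delta\right)^{2^{m+i}+1}.$$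
   Context: $\mathrm{Tr}_m^{2m}(x)=x+x^{2^m}$ is the trace map from $\mathbb{F}_{2^{2m}}$ to $\mathbb{F}_{2^m}$. The compositional inverse of a permutation polynomial $F$ of a finite field $\mathbb{F}$ is the unique polynomial map $F^{ -1}$ with $F(F^{ -1}(x))=F^{ -1}(F(x))=x$ for all $x\in\mathbb{F}$. -}

module Defs where

open import Level using (Level)
open import Data.Nat as ℕ using (ℕ)
open import Data.Fin using (Fin)
open import Data.Product using (∃; _×_)
open import Relation.Nullary using (¬_)
open import Function.Bundles using (Bijection)
open import Algebra.Bundles using (CommutativeRing; Semiring)
import Algebra.Definitions.RawSemiring as RawSemiringDefs
import Relation.Binary.PropositionalEquality as ≡

-- "R is (a model of) the finite field F_{2^n}": R is a field
-- (commutative ring, 1 ≠ 0, every nonzero element invertible) whose carrier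
-- has exactly 2^n elements (a setoid bijection with Fin (2^n)).
-- Any such R is isomorphic to F_{2^n}.
record IsGF2^ {c ℓ : Level} (R : CommutativeRing c ℓ) (n : ℕ) : Set (c Level.⊔ ℓ) where
  open CommutativeRing R
  field
    nontrivial  : ¬ (1# ≈ 0#)
    invertible  : ∀ x → ¬ (x ≈ 0#) → ∃ λ y → x * y ≈ 1#
    cardinality : Bijection setoid (≡.setoid (Fin (2 ℕ.^ n)))

module Maps {c ℓ : Level} (R : CommutativeRing c ℓ) (m k i : ℕ) (δ : CommutativeRing.Carrier R) where
  open CommutativeRing R
  open RawSemiringDefs (Semiring.rawSemiring semiring) using () renaming (_^_ to _^ᴿ_)

  Tr : Carrier → Carrier
  Tr x = x + x ^ᴿ (2 ℕ.^ m)

  E : Carrier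
  E = (δ + δ ^ᴿ (2 ℕ.^ m)) ^ᴿ (2 ℕ.^ i ℕ.+ 1)

  f₂ : Carrier → Carrier
  f₂ x = x + (Tr x ^ᴿ k + δ) ^ᴿ (2 ℕ.^ i ℕ.+ 1)
           + (Tr x ^ᴿ k + δ) ^ᴿ (2 ℕ.^ m ℕ.+ 2 ℕ.^ i)

  f₃ : Carrier → Carrier
  f₃ x = x + (Tr x ^ᴿ k + δ) ^ᴿ (2 ℕ.^ i ℕ.+ 1)
           + (Tr x ^ᴿ k + δ) ^ᴿ (2 ℕ.^ (m ℕ.+ i) ℕ.+ 1)

  f₂⁻¹ : Carrier → Carrier
  f₂⁻¹ x = x + ((Tr x + E) ^ᴿ k + δ) ^ᴿ (2 ℕ.^ i ℕ.+ 1)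
             + ((Tr x + E) ^ᴿ k + δ) ^ᴿ (2 ℕ.^ i ℕ.+ 2 ℕ.^ m)

  f₃⁻¹ : Carrier → Carrier
  f₃⁻¹ x = x + ((Tr x + E) ^ᴿ k + δ) ^ᴿ (2 ℕ.^ i ℕ.+ 1)
             + ((Tr x + E) ^ᴿ k + δ) ^ᴿ (2 ℕ.^ (m ℕ.+ i) ℕ.+ 1)

  IsInverse : (Carrier → Carrier) → (Carrier → Carrier) → Set (c Level.⊔ ℓ)
  IsInverse f g = (∀ x → f (g x) ≈ x) × (∀ x → g (f x) ≈ x)

{-# OPTIONS --safe #-}
-- Write σ a = a ^ 2^m and Tr a = a + σ a. A field with 2^(2m) elements satisfies
-- a ^ 2^(2m) = a, so it has characteristic 2, σ is an additive and multiplicative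
-- involution, and Tr takes values in the subfield fixed by σ, on which Tr vanishes.
-- If Tr (ψ T) = e for every σ-fixed T and e is σ-fixed, then x ↦ x + ψ (Tr x) is
-- inverted by y ↦ y + ψ (Tr y + e), since Tr (x + ψ (Tr x)) = Tr x + e.
-- For t = T ^ k + δ with T fixed, Tr t = Tr δ, and both
-- t ^ (2^i + 1) + t ^ (2^m + 2^i) = t ^ 2^i · Tr t  and
-- t ^ (2^i + 1) + t ^ (2^(m+i) + 1) = (Tr t) ^ 2^i · t
-- have trace (Tr t) ^ (2^i + 1) = (Tr δ) ^ (2^i + 1) = E.
module Submission where

open import Defs
open import Level using (Level)
open import Algebra.Bundles using (CommutativeRing; Semiring)
import Algebra.Definitions.RawSemiring as RawSemiringDefs
open import Data.Nat as ℕ using (ℕ; zero; suc)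
import Data.Nat.Properties as ℕ
open import Data.Fin as Fin using (Fin; punchIn)
open import Data.Fin.Properties using (punchInᵢ≢i)
open import Data.Fin.Permutation using (Permutation; permutation)
open import Data.Vec.Functional using (replicate; removeAt)
open import Data.Empty using (⊥-elim)
open import Data.Product using (∃; _,_; proj₂; _×_)
open import Function.Base using (_∘_)
open import Function.Bundles using (Bijection; Inverse)
open import Function.Properties.Bijection using (Bijection⇒Inverse)
open import Relation.Binary.Definitions using (Decidable)
import Relation.Binary.PropositionalEquality as ≡
open import Relation.Nullary using (¬_; Dec; yes; no)
open import Relation.Nullary.Decidable using (map′)

module _ {c ℓ : Level} (R : CommutativeRing c ℓ) where
  open CommutativeRing R
  open RawSemiringDefs (Semiring.rawSemiring semiring) using (_^_; product)
  open import Relation.Binary.Reasoning.Setoid setoid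
  open import Algebra.Properties.Ring ring using (-1*x≈-x; -‿involutive)
  open import Algebra.Properties.Semiring.Exp semiring using (^-congˡ; ^-congʳ; ^-assocʳ; ^-homo-*)
  open import Algebra.Properties.CommutativeSemiring.Exp commutativeSemiring using (^-distrib-*)
  open import Algebra.Properties.CommutativeSemigroup +-commutativeSemigroup using (interchange)
  import Algebra.Properties.CommutativeMonoid.Sum *-commutativeMonoid as Π

  HasInverse : Carrier → Set (c Level.⊔ ℓ)
  HasInverse a = ∃ λ b → a * b ≈ 1#

  *-hasInverse : ∀ {a b} → HasInverse a → HasInverse b → HasInverse (a * b)
  *-hasInverse {a} {b} (a′ , aa′≈1) (b′ , bb′≈1) = a′ * b′ , (begin
    a * b * (a′ * b′)   ≈⟨ *-assoc a b _ ⟩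
    a * (b * (a′ * b′)) ≈⟨ *-congˡ (*-congˡ (*-comm a′ b′)) ⟩
    a * (b * (b′ * a′)) ≈⟨ *-congˡ (*-assoc b b′ a′) ⟨
    a * (b * b′ * a′)   ≈⟨ *-congˡ (*-congʳ bb′≈1) ⟩
    a * (1# * a′)       ≈⟨ *-congˡ (*-identityˡ a′) ⟩
    a * a′              ≈⟨ aa′≈1 ⟩
    1#                  ∎)

  product-hasInverse : ∀ {r} (v : Fin r → Carrier) → (∀ j → HasInverse (v j)) → HasInverse (product v)
  product-hasInverse {zero}  v _   = 1# , *-identityˡ 1#
  product-hasInverse {suc r} v v⁻¹ =
    *-hasInverse (v⁻¹ Fin.zero) (product-hasInverse (v ∘ Fin.suc) (v⁻¹ ∘ Fin.suc))

  module _ {a a′ : Carrier} (aa′≈1 : a * a′ ≈ 1#) where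
    a′*[a*b]≈b : ∀ b → a′ * (a * b) ≈ b
    a′*[a*b]≈b b = begin
      a′ * (a * b) ≈⟨ *-assoc a′ a b ⟨
      a′ * a * b   ≈⟨ *-congʳ (trans (*-comm a′ a) aa′≈1) ⟩
      1# * b       ≈⟨ *-identityˡ b ⟩
      b            ∎

    a*[a′*b]≈b : ∀ b → a * (a′ * b) ≈ b
    a*[a′*b]≈b b = begin
      a * (a′ * b) ≈⟨ *-assoc a a′ b ⟨
      a * a′ * b   ≈⟨ *-congʳ aa′≈1 ⟩
      1# * b       ≈⟨ *-identityˡ b ⟩
      b            ∎

  *-cancelʳ-hasInverse : ∀ {a b c} → HasInverse c → a * c ≈ b * c → a ≈ b
  *-cancelʳ-hasInverse {a} {b} {c} (c′ , cc′≈1) ac≈bc = begin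
    a            ≈⟨ a′*[a*b]≈b cc′≈1 a ⟨
    c′ * (c * a) ≈⟨ *-congˡ (trans (*-comm c a) (trans ac≈bc (*-comm b c))) ⟩
    c′ * (c * b) ≈⟨ a′*[a*b]≈b cc′≈1 b ⟩
    b            ∎

  module Fermat {n : ℕ} (enum : Bijection setoid (≡.setoid (Fin (suc n))))
                (invertible : ∀ a → ¬ (a ≈ 0#) → HasInverse a) where
    open Inverse (Bijection⇒Inverse enum) using (to; from; to-cong; strictlyInverseˡ; strictlyInverseʳ)

    to-injective : ∀ {a b} → to a ≡.≡ to b → a ≈ b
    to-injective = Bijection.injective enum

    _≟_ : Decidable _≈_
    a ≟ b = map′ to-injective to-cong (to a Fin.≟ to b)

    zero-index : Fin (suc n)
    zero-index = to 0#

    nonzero : Fin n → Carrier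
    nonzero = removeAt from zero-index

    nonzero-≉0 : ∀ j → ¬ (nonzero j ≈ 0#)
    nonzero-≉0 j j≈0 = punchInᵢ≢i zero-index j
      (≡.trans (≡.sym (strictlyInverseˡ (punchIn zero-index j))) (to-cong j≈0))

    -- Replacing 0 by 1 turns the product over all elements into the product of the units,
    -- which lets it be indexed by all of Fin (suc n) and permuted.
    nonzeroOr1 : Carrier → Carrier
    nonzeroOr1 a with a ≟ 0#
    ... | yes _ = 1#
    ... | no _  = a

    nonzeroOr1-0 : ∀ {a} → a ≈ 0# → nonzeroOr1 a ≈ 1#
    nonzeroOr1-0 {a} a≈0 with a ≟ 0#
    ... | yes _  = refl
    ... | no a≉0 = ⊥-elim (a≉0 a≈0)

    nonzeroOr1-≉0 : ∀ {a} → ¬ (a ≈ 0#) → nonzeroOr1 a ≈ a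
    nonzeroOr1-≉0 {a} a≉0 with a ≟ 0#
    ... | yes a≈0 = ⊥-elim (a≉0 a≈0)
    ... | no _    = refl

    nonzeroOr1-cong : ∀ {a b} → a ≈ b → nonzeroOr1 a ≈ nonzeroOr1 b
    nonzeroOr1-cong {a} {b} a≈b = by-cases (b ≟ 0#)
      where
      by-cases : Dec (b ≈ 0#) → nonzeroOr1 a ≈ nonzeroOr1 b
      by-cases (yes b≈0) = trans (nonzeroOr1-0 (trans a≈b b≈0)) (sym (nonzeroOr1-0 b≈0))
      by-cases (no b≉0)  = trans (nonzeroOr1-≉0 (λ a≈0 → b≉0 (trans (sym a≈b) a≈0)))
                                 (trans a≈b (sym (nonzeroOr1-≉0 b≉0)))

    product-nonzeroOr1 : (v : Fin (suc n) → Carrier) → v zero-index ≈ 0# →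
                         (∀ j → ¬ (removeAt v zero-index j ≈ 0#)) →
                         product (nonzeroOr1 ∘ v) ≈ product (removeAt v zero-index)
    product-nonzeroOr1 v v₀≈0 others≉0 = begin
      product (nonzeroOr1 ∘ v)
        ≈⟨ Π.sum-remove {i = zero-index} (nonzeroOr1 ∘ v) ⟩
      nonzeroOr1 (v zero-index) * product (removeAt (nonzeroOr1 ∘ v) zero-index)
        ≈⟨ *-cong (nonzeroOr1-0 v₀≈0) (Π.sum-cong-≋ (nonzeroOr1-≉0 ∘ others≉0)) ⟩
      1# * product (removeAt v zero-index)
        ≈⟨ *-identityˡ _ ⟩
      product (removeAt v zero-index) ∎

    module _ {x x′ : Carrier} (xx′≈1 : x * x′ ≈ 1#) where
      x*-permutation : Permutation (suc n) (suc n)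
      x*-permutation = permutation (λ j → to (x * from j)) (λ j → to (x′ * from j))
        (λ j → ≡.trans (to-cong (trans (*-congˡ (strictlyInverseʳ _)) (a*[a′*b]≈b xx′≈1 (from j))))
                       (strictlyInverseˡ j))
        (λ j → ≡.trans (to-cong (trans (*-congˡ (strictlyInverseʳ _)) (a′*[a*b]≈b xx′≈1 (from j))))
                       (strictlyInverseˡ j))

      product-nonzero-invariant : product nonzero ≈ x ^ n * product nonzero
      product-nonzero-invariant = begin
        product nonzero
          ≈⟨ product-nonzeroOr1 from (strictlyInverseʳ 0#) nonzero-≉0 ⟨
        product (nonzeroOr1 ∘ from)
          ≈⟨ Π.∑-permute (nonzeroOr1 ∘ from) x*-permutation ⟩
        product (λ j → nonzeroOr1 (from (to (x * from j))))
          ≈⟨ Π.sum-cong-≋ (λ j → nonzeroOr1-cong (strictlyInverseʳ (x * from j))) ⟩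
        product (λ j → nonzeroOr1 (x * from j))
          ≈⟨ product-nonzeroOr1 (λ j → x * from j)
               (trans (*-congˡ (strictlyInverseʳ 0#)) (zeroʳ x))
               (λ j xj≈0 → nonzero-≉0 j
                  (trans (sym (a′*[a*b]≈b xx′≈1 (nonzero j))) (trans (*-congˡ xj≈0) (zeroʳ x′)))) ⟩
        product (λ j → x * nonzero j)
          ≈⟨ Π.∑-distrib-+ (replicate n x) nonzero ⟩
        product (replicate n x) * product nonzero
          ≈⟨ *-congʳ (Π.sum-replicate n) ⟩
        x ^ n * product nonzero ∎

    fermat : ∀ x → x ^ suc n ≈ x
    fermat x with x ≟ 0#
    ... | yes x≈0 = trans (*-congʳ x≈0) (trans (zeroˡ _) (sym x≈0))
    ... | no x≉0  = *-cancelʳ-hasInverse product-nonzero-hasInverse (begin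
      x * x ^ n * product nonzero   ≈⟨ *-assoc x _ _ ⟩
      x * (x ^ n * product nonzero) ≈⟨ *-congˡ (product-nonzero-invariant (proj₂ (invertible x x≉0))) ⟨
      x * product nonzero           ∎)
      where
      product-nonzero-hasInverse : HasInverse (product nonzero)
      product-nonzero-hasInverse = product-hasInverse nonzero (λ j → invertible _ (nonzero-≉0 j))

  fermat : ∀ {N} → Bijection setoid (≡.setoid (Fin N)) →
           (∀ a → ¬ (a ≈ 0#) → HasInverse a) → ∀ a → a ^ N ≈ a
  fermat {zero}  enum _          a with () ← Bijection.to enum a
  fermat {suc n} enum invertible = Fermat.fermat enum invertible

  1#^r≈1# : ∀ r → 1# ^ r ≈ 1#
  1#^r≈1# zero    = refl
  1#^r≈1# (suc r) = trans (*-identityˡ _) (1#^r≈1# r)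

  -- Applied to -1, an even exponent gives 1 ≈ -1.
  even-fermat⇒char2 : ∀ r → (∀ a → a ^ (2 ℕ.* r) ≈ a) → ∀ a → a + a ≈ 0#
  even-fermat⇒char2 r fermat-2r a = begin
    a + a               ≈⟨ +-cong (*-identityˡ a) (*-identityˡ a) ⟨
    1# * a + 1# * a     ≈⟨ distribʳ a 1# 1# ⟨
    (1# + 1#) * a       ≈⟨ *-congʳ (+-congˡ 1#≈-1#) ⟩
    (1# + - 1#) * a     ≈⟨ *-congʳ (-‿inverseʳ 1#) ⟩
    0# * a              ≈⟨ zeroˡ a ⟩
    0#                  ∎
    where
    1#≈-1# : 1# ≈ - 1#
    1#≈-1# = begin
      1#                   ≈⟨ 1#^r≈1# r ⟨
      1# ^ r               ≈⟨ ^-congˡ r (trans (*-congˡ (*-identityʳ _)) (trans (-1*x≈-x (- 1#)) (-‿involutive 1#))) ⟨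
      ((- 1#) ^ 2) ^ r     ≈⟨ ^-assocʳ (- 1#) 2 r ⟩
      (- 1#) ^ (2 ℕ.* r)   ≈⟨ fermat-2r (- 1#) ⟩
      - 1#                 ∎

  x^[r+1]≈x^r*x : ∀ x r → x ^ (r ℕ.+ 1) ≈ x ^ r * x
  x^[r+1]≈x^r*x x r = trans (^-homo-* x r 1) (*-congˡ (*-identityʳ x))

  [x^r]^s≈[x^s]^r : ∀ x r s → (x ^ r) ^ s ≈ (x ^ s) ^ r
  [x^r]^s≈[x^s]^r x r s = begin
    (x ^ r) ^ s    ≈⟨ ^-assocʳ x r s ⟩
    x ^ (r ℕ.* s)  ≈⟨ ^-congʳ x (ℕ.*-comm r s) ⟩
    x ^ (s ℕ.* r)  ≈⟨ ^-assocʳ x s r ⟨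
    (x ^ s) ^ r    ∎

  module Characteristic2 (x+x≈0 : ∀ x → x + x ≈ 0#) where
    x+y+y≈x : ∀ x y → x + y + y ≈ x
    x+y+y≈x x y = begin
      x + y + y   ≈⟨ +-assoc x y y ⟩
      x + (y + y) ≈⟨ +-congˡ (x+x≈0 y) ⟩
      x + 0#      ≈⟨ +-identityʳ x ⟩
      x           ∎

    [x+y]²≈x²+y² : ∀ x y → (x + y) ^ 2 ≈ x ^ 2 + y ^ 2
    [x+y]²≈x²+y² x y = begin
      (x + y) ^ 2                   ≈⟨ *-congˡ (*-identityʳ _) ⟩
      (x + y) * (x + y)             ≈⟨ distribʳ _ x y ⟩
      x * (x + y) + y * (x + y)     ≈⟨ +-cong (distribˡ x x y) (distribˡ y x y) ⟩
      (x * x + x * y) + (y * x + y * y) ≈⟨ +-congˡ (+-comm _ _) ⟩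
      (x * x + x * y) + (y * y + y * x) ≈⟨ interchange _ _ _ _ ⟩
      (x * x + y * y) + (x * y + y * x) ≈⟨ +-congˡ (trans (+-congˡ (*-comm y x)) (x+x≈0 _)) ⟩
      (x * x + y * y) + 0#          ≈⟨ +-identityʳ _ ⟩
      x * x + y * y                 ≈⟨ +-cong (*-congˡ (*-identityʳ x)) (*-congˡ (*-identityʳ y)) ⟨
      x ^ 2 + y ^ 2                 ∎

    frobenius : ∀ n x y → (x + y) ^ (2 ℕ.^ n) ≈ x ^ (2 ℕ.^ n) + y ^ (2 ℕ.^ n)
    frobenius zero x y =
      trans (*-identityʳ _) (sym (+-cong (*-identityʳ x) (*-identityʳ y)))
    frobenius (suc n) x y = begin
      (x + y) ^ (2 ℕ.* s)           ≈⟨ ^-assocʳ (x + y) 2 s ⟨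
      ((x + y) ^ 2) ^ s             ≈⟨ ^-congˡ s ([x+y]²≈x²+y² x y) ⟩
      (x ^ 2 + y ^ 2) ^ s           ≈⟨ frobenius n _ _ ⟩
      (x ^ 2) ^ s + (y ^ 2) ^ s     ≈⟨ +-cong (^-assocʳ x 2 s) (^-assocʳ y 2 s) ⟩
      x ^ (2 ℕ.* s) + y ^ (2 ℕ.* s) ∎
      where s = 2 ℕ.^ n

    module RelativeTrace (m : ℕ) (fermat-2m : ∀ x → x ^ (2 ℕ.^ (2 ℕ.* m)) ≈ x) where
      q : ℕ
      q = 2 ℕ.^ m

      σ : Carrier → Carrier
      σ x = x ^ q

      Tr : Carrier → Carrier
      Tr x = x + σ x

      Fixed : Carrier → Set ℓ
      Fixed x = σ x ≈ x

      σ-cong : ∀ {x y} → x ≈ y → σ x ≈ σ y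
      σ-cong = ^-congˡ q

      σ-+ : ∀ x y → σ (x + y) ≈ σ x + σ y
      σ-+ = frobenius m

      σ-* : ∀ x y → σ (x * y) ≈ σ x * σ y
      σ-* x y = ^-distrib-* x y q

      σ-^ : ∀ x r → σ (x ^ r) ≈ σ x ^ r
      σ-^ x r = [x^r]^s≈[x^s]^r x r q

      σ-involutive : ∀ x → σ (σ x) ≈ x
      σ-involutive x = begin
        (x ^ q) ^ q                    ≈⟨ ^-assocʳ x q q ⟩
        x ^ (q ℕ.* 2 ℕ.^ m)            ≈⟨ ^-congʳ x (≡.cong (λ j → q ℕ.* 2 ℕ.^ j) (ℕ.+-identityʳ m)) ⟨
        x ^ (q ℕ.* 2 ℕ.^ (m ℕ.+ 0))    ≈⟨ ^-congʳ x (ℕ.^-distribˡ-+-* 2 m (m ℕ.+ 0)) ⟨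
        x ^ (2 ℕ.^ (2 ℕ.* m))          ≈⟨ fermat-2m x ⟩
        x                              ∎

      fixed-^ : ∀ {x} r → Fixed x → Fixed (x ^ r)
      fixed-^ {x} r σx≈x = trans (σ-^ x r) (^-congˡ r σx≈x)

      Tr-cong : ∀ {x y} → x ≈ y → Tr x ≈ Tr y
      Tr-cong x≈y = +-cong x≈y (σ-cong x≈y)

      Tr-+ : ∀ x y → Tr (x + y) ≈ Tr x + Tr y
      Tr-+ x y = trans (+-congˡ (σ-+ x y)) (interchange x y (σ x) (σ y))

      Tr-fixed : ∀ x → Fixed (Tr x)
      Tr-fixed x = begin
        σ (x + σ x)       ≈⟨ σ-+ x (σ x) ⟩
        σ x + σ (σ x)     ≈⟨ +-congˡ (σ-involutive x) ⟩
        σ x + x           ≈⟨ +-comm _ _ ⟩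
        x + σ x           ∎

      fixed-+ : ∀ {x y} → Fixed x → Fixed y → Fixed (x + y)
      fixed-+ {x} {y} σx≈x σy≈y = trans (σ-+ x y) (+-cong σx≈x σy≈y)

      Tr-fixed≈0 : ∀ {x} → Fixed x → Tr x ≈ 0#
      Tr-fixed≈0 {x} σx≈x = trans (+-congˡ σx≈x) (x+x≈0 x)

      Tr-*-fixed : ∀ x {d} → Fixed d → Tr (x * d) ≈ Tr x * d
      Tr-*-fixed x {d} σd≈d = begin
        x * d + σ (x * d)  ≈⟨ +-congˡ (trans (σ-* x d) (*-congˡ σd≈d)) ⟩
        x * d + σ x * d    ≈⟨ distribʳ d x (σ x) ⟨
        (x + σ x) * d      ∎

      Tr-^2^ : ∀ i x → Tr (x ^ (2 ℕ.^ i)) ≈ Tr x ^ (2 ℕ.^ i)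
      Tr-^2^ i x = trans (+-congˡ (σ-^ x (2 ℕ.^ i))) (sym (frobenius i x (σ x)))

      Tr[T^k+δ]≈Tr[δ] : ∀ {T} k δ → Fixed T → Tr (T ^ k + δ) ≈ Tr δ
      Tr[T^k+δ]≈Tr[δ] {T} k δ σT≈T = begin
        Tr (T ^ k + δ)       ≈⟨ Tr-+ (T ^ k) δ ⟩
        Tr (T ^ k) + Tr δ    ≈⟨ +-congʳ (Tr-fixed≈0 (fixed-^ k σT≈T)) ⟩
        0# + Tr δ            ≈⟨ +-identityˡ _ ⟩
        Tr δ                 ∎

      Tr[x^[p+1]+x^[q+p]] : ∀ i x → let p = 2 ℕ.^ i in
                            Tr (x ^ (p ℕ.+ 1) + x ^ (q ℕ.+ p)) ≈ Tr x ^ (p ℕ.+ 1)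
      Tr[x^[p+1]+x^[q+p]] i x = begin
        Tr (x ^ (p ℕ.+ 1) + x ^ (q ℕ.+ p))
          ≈⟨ Tr-cong (+-cong (x^[r+1]≈x^r*x x p) (trans (^-homo-* x q p) (*-comm _ _))) ⟩
        Tr (x ^ p * x + x ^ p * σ x)   ≈⟨ Tr-cong (distribˡ (x ^ p) x (σ x)) ⟨
        Tr (x ^ p * Tr x)              ≈⟨ Tr-*-fixed (x ^ p) (Tr-fixed x) ⟩
        Tr (x ^ p) * Tr x              ≈⟨ *-congʳ (Tr-^2^ i x) ⟩
        Tr x ^ p * Tr x                ≈⟨ x^[r+1]≈x^r*x (Tr x) p ⟨
        Tr x ^ (p ℕ.+ 1)               ∎
        where p = 2 ℕ.^ i

      Tr[x^[p+1]+x^[qp+1]] : ∀ i x → let p = 2 ℕ.^ i in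
                             Tr (x ^ (p ℕ.+ 1) + x ^ (2 ℕ.^ (m ℕ.+ i) ℕ.+ 1)) ≈ Tr x ^ (p ℕ.+ 1)
      Tr[x^[p+1]+x^[qp+1]] i x = begin
        Tr (x ^ (p ℕ.+ 1) + x ^ (2 ℕ.^ (m ℕ.+ i) ℕ.+ 1))
          ≈⟨ Tr-cong (+-cong (x^[r+1]≈x^r*x x p) (x^[r+1]≈x^r*x x (2 ℕ.^ (m ℕ.+ i)))) ⟩
        Tr (x ^ p * x + x ^ (2 ℕ.^ (m ℕ.+ i)) * x)
          ≈⟨ Tr-cong (+-congˡ (*-congʳ (trans (^-congʳ x (ℕ.^-distribˡ-+-* 2 m i)) (sym (^-assocʳ x q p))))) ⟩
        Tr (x ^ p * x + σ x ^ p * x)   ≈⟨ Tr-cong (distribʳ x (x ^ p) (σ x ^ p)) ⟨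
        Tr ((x ^ p + σ x ^ p) * x)     ≈⟨ Tr-cong (*-congʳ (+-congˡ (σ-^ x p))) ⟨
        Tr (Tr (x ^ p) * x)            ≈⟨ Tr-cong (*-congʳ (Tr-^2^ i x)) ⟩
        Tr (Tr x ^ p * x)              ≈⟨ Tr-cong (*-comm _ x) ⟩
        Tr (x * Tr x ^ p)              ≈⟨ Tr-*-fixed x (fixed-^ p (Tr-fixed x)) ⟩
        Tr x * Tr x ^ p                ≈⟨ trans (x^[r+1]≈x^r*x (Tr x) p) (*-comm _ _) ⟨
        Tr x ^ (p ℕ.+ 1)               ∎
        where p = 2 ℕ.^ i

      module TraceShear (ψ : Carrier → Carrier) (ψ-cong : ∀ {x y} → x ≈ y → ψ x ≈ ψ y)
                        {e : Carrier} (e-fixed : Fixed e)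
                        (Tr∘ψ≈e : ∀ {T} → Fixed T → Tr (ψ T) ≈ e) where
        f : Carrier → Carrier
        f x = x + ψ (Tr x)

        f⁻¹ : Carrier → Carrier
        f⁻¹ y = y + ψ (Tr y + e)

        f-cong : ∀ {x y} → x ≈ y → f x ≈ f y
        f-cong x≈y = +-cong x≈y (ψ-cong (Tr-cong x≈y))

        f⁻¹-cong : ∀ {x y} → x ≈ y → f⁻¹ x ≈ f⁻¹ y
        f⁻¹-cong x≈y = +-cong x≈y (ψ-cong (+-congʳ (Tr-cong x≈y)))

        Tr∘f : ∀ x → Tr (f x) ≈ Tr x + e
        Tr∘f x = trans (Tr-+ x _) (+-congˡ (Tr∘ψ≈e (Tr-fixed x)))

        f⁻¹∘f : ∀ x → f⁻¹ (f x) ≈ x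
        f⁻¹∘f x = begin
          f x + ψ (Tr (f x) + e) ≈⟨ +-congˡ (ψ-cong (trans (+-congʳ (Tr∘f x)) (x+y+y≈x _ e))) ⟩
          f x + ψ (Tr x)         ≈⟨ x+y+y≈x x _ ⟩
          x                      ∎

        f∘f⁻¹ : ∀ y → f (f⁻¹ y) ≈ y
        f∘f⁻¹ y = begin
          f⁻¹ y + ψ (Tr (f⁻¹ y)) ≈⟨ +-congˡ (ψ-cong Tr∘f⁻¹) ⟩
          f⁻¹ y + ψ (Tr y + e)   ≈⟨ x+y+y≈x y _ ⟩
          y                      ∎
          where
          Tr∘f⁻¹ : Tr (f⁻¹ y) ≈ Tr y + e
          Tr∘f⁻¹ = trans (Tr-+ y _) (+-congˡ (Tr∘ψ≈e (fixed-+ (Tr-fixed y) e-fixed)))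

        inverse-resp-≈ : {g g⁻¹ : Carrier → Carrier} → (∀ x → g x ≈ f x) → (∀ y → g⁻¹ y ≈ f⁻¹ y) →
                         (∀ y → g (g⁻¹ y) ≈ y) × (∀ x → g⁻¹ (g x) ≈ x)
        inverse-resp-≈ {g} {g⁻¹} g≈f g⁻¹≈f⁻¹ =
          (λ y → trans (g≈f _) (trans (f-cong (g⁻¹≈f⁻¹ y)) (f∘f⁻¹ y))) ,
          (λ x → trans (g⁻¹≈f⁻¹ _) (trans (f⁻¹-cong (g≈f x)) (f⁻¹∘f x)))

      module _ (k i : ℕ) (δ : Carrier) where
        open Maps R m k i δ using (f₂; f₂⁻¹; f₃; f₃⁻¹; IsInverse)

        p : ℕ
        p = 2 ℕ.^ i

        E-fixed : Fixed (Tr δ ^ (p ℕ.+ 1))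
        E-fixed = fixed-^ (p ℕ.+ 1) (Tr-fixed δ)

        shift-cong : ∀ {x y} → x ≈ y → x ^ k + δ ≈ y ^ k + δ
        shift-cong x≈y = +-congʳ (^-congˡ k x≈y)

        module Shear₂ = TraceShear
          (λ T → (T ^ k + δ) ^ (p ℕ.+ 1) + (T ^ k + δ) ^ (q ℕ.+ p))
          (λ x≈y → +-cong (^-congˡ (p ℕ.+ 1) (shift-cong x≈y)) (^-congˡ (q ℕ.+ p) (shift-cong x≈y)))
          E-fixed
          (λ {T} σT≈T → trans (Tr[x^[p+1]+x^[q+p]] i (T ^ k + δ))
                              (^-congˡ (p ℕ.+ 1) (Tr[T^k+δ]≈Tr[δ] k δ σT≈T)))

        module Shear₃ = TraceShear
          (λ T → (T ^ k + δ) ^ (p ℕ.+ 1) + (T ^ k + δ) ^ (2 ℕ.^ (m ℕ.+ i) ℕ.+ 1))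
          (λ x≈y → +-cong (^-congˡ (p ℕ.+ 1) (shift-cong x≈y))
                          (^-congˡ (2 ℕ.^ (m ℕ.+ i) ℕ.+ 1) (shift-cong x≈y)))
          E-fixed
          (λ {T} σT≈T → trans (Tr[x^[p+1]+x^[qp+1]] i (T ^ k + δ))
                              (^-congˡ (p ℕ.+ 1) (Tr[T^k+δ]≈Tr[δ] k δ σT≈T)))

        f₂-inverse : IsInverse f₂ f₂⁻¹
        f₂-inverse = Shear₂.inverse-resp-≈ (λ _ → +-assoc _ _ _)
          (λ _ → trans (+-assoc _ _ _) (+-congˡ (+-congˡ (^-congʳ _ (ℕ.+-comm p q)))))

        f₃-inverse : IsInverse f₃ f₃⁻¹
        f₃-inverse = Shear₃.inverse-resp-≈ (λ _ → +-assoc _ _ _) (λ _ → +-assoc _ _ _)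

  module FieldOfOrder2^2m {m′ : ℕ} (isGF : IsGF2^ R (2 ℕ.* suc m′)) where
    open IsGF2^ isGF using (cardinality; invertible)

    fermat-2m : ∀ x → x ^ (2 ℕ.^ (2 ℕ.* suc m′)) ≈ x
    fermat-2m = fermat cardinality invertible

    open Characteristic2 (even-fermat⇒char2 (2 ℕ.^ (m′ ℕ.+ 1 ℕ.* suc m′)) fermat-2m) public
    open RelativeTrace (suc m′) fermat-2m public

open import Data.Nat using (ℕ; _*_; _<_; _≤_)

theorem13 : {c ℓ : Level} (R : CommutativeRing c ℓ) (m k i : ℕ) →
    1 ≤ m → 1 ≤ k → 0 < i → i < m →
    IsGF2^ R (2 * m) →
    (δ : CommutativeRing.Carrier R) →
    Maps.IsInverse R m k i δ (Maps.f₂ R m k i δ) (Maps.f₂⁻¹ R m k i δ)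
    × Maps.IsInverse R m k i δ (Maps.f₃ R m k i δ) (Maps.f₃⁻¹ R m k i δ)
theorem13 R (suc m′) k i _ _ _ _ isGF δ = f₂-inverse k i δ , f₃-inverse k i δ
  where open FieldOfOrder2^2m R isGF
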